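{- Let $G$ be a non-trivial connected graph. Then there exists a $2$-rainbow dominating function of $G\circ K_2$ of minimum weight whose induced partition $(V_\emptyset,V_1,V_2,V_{12})$ of $V(G\circ K_2)$ satisfies that both $\pi_G(V_1\cup V_{12})$ and $\pi_G(V_2\cup V_{12})$ are dominating sets of $G$.
   Context: All graphs are finite and simple; non-trivial means at least two vertices; $K_2$ is the complete graph on two vertices. A $2$-rainbow dominating function of a graph $X$ is a map $f\colon V(X)\to 2^{\{1,2\}}$ such that for every vertex $v$ with $f(v)=\emptyset$ we have $\bigcup_{u\in N(v)} f(u)=\{1,2\}$; its weight is $\|f\|=\sum_v |f(v)|$. For such $f$, $V_\emptyset,V_1,V_2,V_{12}$ denote the sets of vertices $v$ with $f(v)=\emptyset,\{1\},\{2\},\{1,2\}$ respectively. The lexicographic product $G\circ H$ has vertex set $V(G)\times V(H)$, with $(g_1,h_1)$ adjacent to $(g_2,h_2)$ iff $g_1g_2\in E(G)$, or $g_1=g_2$ and $h_1h_2\in E(H)$. $\pi_G(g,h)=g$ is the projection onto $G$. A set $D\subseteq V(G)$ dominates $G$ if every vertex of $G$ is in $D$ or adjacent to a vertex of $D$. -}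

module Defs where

open import Data.Nat using (ℕ; zero; suc; _+_; _≤_)
open import Data.Fin using (Fin)
open import Data.Bool using (Bool; true; false; _∧_; _∨_; T)
open import Data.Product using (Σ; ∃; _×_; _,_)
open import Data.Sum using (_⊎_)
open import Data.Empty using (⊥)
open import Data.List using (List; []; _∷_; allFin; map)
open import Data.Nat.ListAction using (sum)
open import Data.Unit using (⊤)
open import Relation.Binary.PropositionalEquality using (_≡_)
open import Relation.Nullary using (¬_)

record Graph : Set where
  field
    n     : ℕ
    adj   : Fin n → Fin n → Bool
    sym   : ∀ u v → adj u v ≡ adj v u
    irref : ∀ v → adj v v ≡ false

open Graph public

Vtx : Graph → Set
Vtx G = Fin (n G)

Adj : (G : Graph) → Vtx G → Vtx G → Set
Adj G u v = T (adj G u v)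

data Walk (G : Graph) : Vtx G → Vtx G → Set where
  here : ∀ {v} → Walk G v v
  step : ∀ {u v w} → Adj G u v → Walk G v w → Walk G u w

Connected : Graph → Set
Connected G = ∀ u v → Walk G u v

NonTrivial : Graph → Set
NonTrivial G = 2 ≤ n G

K₂ : Graph
K₂ = record { n = 2 ; adj = a ; sym = s ; irref = i }
  where
  a : Fin 2 → Fin 2 → Bool
  a Fin.zero Fin.zero = false
  a Fin.zero (Fin.suc Fin.zero) = true
  a (Fin.suc Fin.zero) Fin.zero = true
  a (Fin.suc Fin.zero) (Fin.suc Fin.zero) = false
  s : ∀ u v → a u v ≡ a v u
  s Fin.zero Fin.zero = _≡_.refl
  s Fin.zero (Fin.suc Fin.zero) = _≡_.refl
  s (Fin.suc Fin.zero) Fin.zero = _≡_.refl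
  s (Fin.suc Fin.zero) (Fin.suc Fin.zero) = _≡_.refl
  i : ∀ v → a v v ≡ false
  i Fin.zero = _≡_.refl
  i (Fin.suc Fin.zero) = _≡_.refl

-- Lexicographic product G ∘ H: vertex set V(G) × V(H),
-- (g₁,h₁) ~ (g₂,h₂) iff g₁g₂ ∈ E(G), or g₁ = g₂ and h₁h₂ ∈ E(H).
LexVtx : Graph → Graph → Set
LexVtx G H = Vtx G × Vtx H

LexAdj : (G H : Graph) → LexVtx G H → LexVtx G H → Set
LexAdj G H (g₁ , h₁) (g₂ , h₂) = Adj G g₁ g₂ ⊎ (g₁ ≡ g₂ × Adj H h₁ h₂)

πG : {G H : Graph} → LexVtx G H → Vtx G
πG (g , _) = g

data Label : Set where
  ∅ : Label
  l1 : Label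
  l2 : Label
  l12 : Label

Has1 : Label → Set
Has1 l1 = ⊤
Has1 l12 = ⊤
Has1 _ = ⊥

Has2 : Label → Set
Has2 l2 = ⊤
Has2 l12 = ⊤
Has2 _ = ⊥

size : Label → ℕ
size ∅ = 0
size l1 = 1
size l2 = 1
size l12 = 2

ΣFin : (m : ℕ) → (Fin m → ℕ) → ℕ
ΣFin m f = sum (map f (allFin m))

IsRDF : (G H : Graph) → (LexVtx G H → Label) → Set
IsRDF G H f = ∀ v → f v ≡ ∅ →
  (∃ λ u → LexAdj G H v u × Has1 (f u)) × (∃ λ u → LexAdj G H v u × Has2 (f u))

weight : (G H : Graph) → (LexVtx G H → Label) → ℕ
weight G H f = ΣFin (n G) λ g → ΣFin (n H) λ h → size (f (g , h))

IsMinRDF : (G H : Graph) → (LexVtx G H → Label) → Set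
IsMinRDF G H f = IsRDF G H f × (∀ f' → IsRDF G H f' → weight G H f ≤ weight G H f')

Dominates : (G : Graph) → (Vtx G → Set) → Set
Dominates G D = ∀ v → D v ⊎ (∃ λ u → Adj G v u × D u)

proj1 : (G H : Graph) → (LexVtx G H → Label) → Vtx G → Set
proj1 G H f g = ∃ λ h → Has1 (f (g , h))

proj2 : (G H : Graph) → (LexVtx G H → Label) → Vtx G → Set
proj2 G H f g = ∃ λ h → Has2 (f (g , h))

-- In G ∘ K₂ the two vertices of a fibre {g} × V(K₂) are adjacent twins, so the
-- colour 1 of one of them may be recoloured 2 (or vice versa) whenever the other
-- one also carries it: every vertex that saw it still sees it through the twin,
-- and the weight is unchanged.  Doing so in every fibre labelled ({1},{1}) or
-- ({2},{2}) turns a minimum 2RDF into one in which each fibre either contains an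
-- empty vertex or carries both colours.  A vertex g whose fibre misses colour c
-- then has an empty vertex in its fibre, whose c-coloured neighbour must lie in
-- another fibre, i.e. over a neighbour of g in G.
module Submission where

open import Defs
open import Data.Nat using (ℕ; zero; suc; _≤_)
open import Data.Nat.Properties using (≤-reflexive)
open import Data.Fin using (Fin; zero; suc; _≟_)
open import Data.Fin.Properties using (any?; all?)
open import Data.Product using (∃; _×_; _,_; proj₁; proj₂; curry; uncurry)
open import Data.Sum using (_⊎_; inj₁; inj₂)
open import Data.Unit using (tt)
open import Data.List using (List; []; _∷_; [_]; map; filter; allFin; cartesianProductWith)
open import Data.List.Properties using (map-cong)
open import Data.List.Relation.Unary.Any as Any using (Any; here; there)
open import Data.List.Relation.Unary.Any.Properties using (cartesianProductWith⁺; map⁺; filter⁺; lookup-result)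
open import Data.List.Relation.Unary.All.Properties using (all-filter)
open import Data.List.Extrema.Nat using (argmin; argmin-all; f[argmin]≤v⁺)
open import Data.Nat.ListAction using (sum)
open import Data.Vec.Functional as Vector using (Vector)
open import Relation.Binary.PropositionalEquality as ≡ using (_≡_; _≗_; refl; trans; cong; subst)
open import Relation.Nullary using (¬_; Dec; yes; no; contradiction)
open import Relation.Nullary.Decidable using (map′; _×-dec_; _⊎-dec_; _→-dec_; T?)
open import Relation.Unary using (Decidable)

data Colour : Set where
  c₁ c₂ : Colour

Has : Colour → Label → Set
Has c₁ = Has1
Has c₂ = Has2

¬Has-∅ : ∀ c → ¬ Has c ∅
¬Has-∅ c₁ ()
¬Has-∅ c₂ ()

proj : Colour → (G H : Graph) → (LexVtx G H → Label) → Vtx G → Set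
proj c G H f g = ∃ λ h → Has c (f (g , h))

rdf-neighbour : {G H : Graph} {f : LexVtx G H → Label} → IsRDF G H f →
                ∀ c v → f v ≡ ∅ → ∃ λ u → LexAdj G H v u × Has c (f u)
rdf-neighbour rdf c₁ v e = proj₁ (rdf v e)
rdf-neighbour rdf c₂ v e = proj₂ (rdf v e)

FibreCovered : Colour → (G H : Graph) → (LexVtx G H → Label) → Vtx G → Set
FibreCovered c G H f g = (∃ λ h → f (g , h) ≡ ∅) ⊎ proj c G H f g

proj-dominates : {G H : Graph} {f : LexVtx G H → Label} → IsRDF G H f →
                 ∀ c → (∀ g → FibreCovered c G H f g) → Dominates G (proj c G H f)
proj-dominates {G} {H} {f} rdf c covered g with covered g
... | inj₂ p = inj₁ p
... | inj₁ (h , e) with rdf-neighbour {G} {H} {f} rdf c (g , h) e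
...   | (g′ , h′) , inj₁ g~g′ , p = inj₂ (g′ , g~g′ , h′ , p)
...   | (g′ , h′) , inj₂ (refl , _) , p = inj₁ (h′ , p)

ΣFin-cong : ∀ m {u v : Fin m → ℕ} → u ≗ v → ΣFin m u ≡ ΣFin m v
ΣFin-cong m u≗v = cong sum (map-cong u≗v (allFin m))

module _ {G H : Graph} {f f′ : LexVtx G H → Label} where

  weight-cong-size : (∀ v → size (f v) ≡ size (f′ v)) → weight G H f ≡ weight G H f′
  weight-cong-size eq = ΣFin-cong (n G) λ g → ΣFin-cong (n H) λ h → eq (g , h)

  weight-cong : f ≗ f′ → weight G H f ≡ weight G H f′
  weight-cong f≗f′ = weight-cong-size (λ v → cong size (f≗f′ v))

  isRDF-cong : f ≗ f′ → IsRDF G H f → IsRDF G H f′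
  isRDF-cong f≗f′ rdf v e = transport c₁ , transport c₂
    where
    transport : ∀ c → ∃ λ u → LexAdj G H v u × Has c (f′ u)
    transport c with rdf-neighbour {G} {H} {f} rdf c v (trans (f≗f′ v) e)
    ... | u , v~u , p = u , v~u , subst (Has c) (f≗f′ u) p

has? : ∀ c l → Dec (Has c l)
has? c₁ ∅   = no λ ()
has? c₁ l1  = yes tt
has? c₁ l2  = no λ ()
has? c₁ l12 = yes tt
has? c₂ ∅   = no λ ()
has? c₂ l1  = no λ ()
has? c₂ l2  = yes tt
has? c₂ l12 = yes tt

empty? : ∀ l → Dec (l ≡ ∅)
empty? ∅   = yes refl
empty? l1  = no λ ()
empty? l2  = no λ ()
empty? l12 = no λ ()

module _ {a b : ℕ} {P : Fin a × Fin b → Set} (P? : Decidable P) where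

  all-pairs? : Dec (∀ v → P v)
  all-pairs? = map′ uncurry curry (all? λ g → all? λ h → P? (g , h))

  any-pairs? : Dec (∃ P)
  any-pairs? = map′ (λ (g , h , p) → (g , h) , p) (λ ((g , h) , p) → g , h , p)
                    (any? λ g → any? λ h → P? (g , h))

module _ (G H : Graph) where

  lexAdj? : ∀ u v → Dec (LexAdj G H u v)
  lexAdj? (g₁ , h₁) (g₂ , h₂) = T? (adj G g₁ g₂) ⊎-dec (g₁ ≟ g₂ ×-dec T? (adj H h₁ h₂))

  isRDF? : Decidable (IsRDF G H)
  isRDF? f = all-pairs? λ v → empty? (f v) →-dec (neighbour? c₁ v ×-dec neighbour? c₂ v)
    where
    neighbour? : ∀ c v → Dec (∃ λ u → LexAdj G H v u × Has c (f u))
    neighbour? c v = any-pairs? λ u → lexAdj? v u ×-dec has? c (f u)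

functions : {A : Set} → List A → (k : ℕ) → List (Vector A k)
functions xs zero    = [ (λ ()) ]
functions xs (suc k) = cartesianProductWith Vector._∷_ xs (functions xs k)

functions-complete : {A : Set} {R : A → A → Set} {xs : List A} →
                     (∀ x → Any (R x) xs) →
                     ∀ k (f : Vector A k) → Any (λ f′ → ∀ i → R (f i) (f′ i)) (functions xs k)
functions-complete complete zero    f = here λ ()
functions-complete {R = R} complete (suc k) f =
  cartesianProductWith⁺ Vector._∷_ cons (complete (f zero))
                        (functions-complete complete k (λ i → f (suc i)))
  where
  cons : ∀ {x f′} → R (f zero) x → (∀ i → R (f (suc i)) (f′ i)) → ∀ i → R (f i) ((x Vector.∷ f′) i)
  cons r rs zero    = r
  cons r rs (suc i) = rs i

-- Candidate lists are complete only up to pointwise equality (_≈_), for lack of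
-- function extensionality.
module _ {A : Set} {_≈_ : A → A → Set} {P : A → Set} (P? : Decidable P) (w : A → ℕ)
         (P-resp : ∀ {x y} → x ≈ y → P x → P y) (w-resp : ∀ {x y} → x ≈ y → w x ≡ w y)
         (xs : List A) (complete : ∀ x → Any (x ≈_) xs) where

  minimum-exists : ∀ {x₀} → P x₀ → ∃ λ m → P m × (∀ x → P x → w m ≤ w x)
  minimum-exists {x₀} p₀ = m , argmin-all w p₀ (all-filter P? xs) , minimal
    where
    m : A
    m = argmin w x₀ (filter P? xs)

    representative : ∀ x → P x → Any (λ y → x ≈ y × P y) xs
    representative x px = Any.map (λ x≈y → x≈y , P-resp x≈y px) (complete x)

    minimal : ∀ x → P x → w m ≤ w x
    minimal x px with filter⁺ P? (representative x px)
    ... | inj₁ found = f[argmin]≤v⁺ x₀ (filter P? xs)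
                         (inj₂ (Any.map (λ (x≈y , _) → ≤-reflexive (≡.sym (w-resp x≈y))) found))
    ... | inj₂ ¬py   = contradiction (proj₂ (lookup-result (representative x px))) ¬py

labels : List Label
labels = ∅ ∷ l1 ∷ l2 ∷ l12 ∷ []

labels-complete : ∀ l → Any (l ≡_) labels
labels-complete ∅   = here refl
labels-complete l1  = there (here refl)
labels-complete l2  = there (there (here refl))
labels-complete l12 = there (there (there (here refl)))

∃-minimumRDF : (G H : Graph) → ∃ (IsMinRDF G H)
∃-minimumRDF G H = minimum-exists (isRDF? G H) (weight G H) (isRDF-cong {G} {H}) (weight-cong {G} {H})
                                  candidates complete {λ _ → l12} (λ _ ())
  where
  candidates : List (LexVtx G H → Label)
  candidates = map uncurry (functions (functions labels (n H)) (n G))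

  complete : ∀ f → Any (f ≗_) candidates
  complete f = map⁺ (Any.map uncurry′ (functions-complete (functions-complete labels-complete (n H))
                                                          (n G) (curry f)))
    where
    uncurry′ : ∀ {c} → (∀ g h → f (g , h) ≡ c g h) → f ≗ uncurry c
    uncurry′ eq (g , h) = eq g h

balance : Label → Label → Label
balance l1 l1 = l2
balance l2 l2 = l1
balance a  _  = a

balance-size : ∀ a b → size (balance a b) ≡ size a
balance-size ∅   _   = refl
balance-size l1  ∅   = refl
balance-size l1  l1  = refl
balance-size l1  l2  = refl
balance-size l1  l12 = refl
balance-size l2  ∅   = refl
balance-size l2  l1  = refl
balance-size l2  l2  = refl
balance-size l2  l12 = refl
balance-size l12 _   = refl

size≡0⇒∅ : ∀ a → size a ≡ 0 → a ≡ ∅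
size≡0⇒∅ ∅ _ = refl

balance-∅ : ∀ a b → balance a b ≡ ∅ → a ≡ ∅
balance-∅ a b e = size≡0⇒∅ a (trans (≡.sym (balance-size a b)) (cong size e))

balance-keeps : ∀ c a b → Has c a → Has c (balance a b) ⊎ Has c b
balance-keeps c₁ l1  ∅   _ = inj₁ tt
balance-keeps c₁ l1  l1  _ = inj₂ tt
balance-keeps c₁ l1  l2  _ = inj₁ tt
balance-keeps c₁ l1  l12 _ = inj₁ tt
balance-keeps c₁ l12 _   _ = inj₁ tt
balance-keeps c₂ l2  ∅   _ = inj₁ tt
balance-keeps c₂ l2  l1  _ = inj₁ tt
balance-keeps c₂ l2  l2  _ = inj₂ tt
balance-keeps c₂ l2  l12 _ = inj₁ tt
balance-keeps c₂ l12 _   _ = inj₁ tt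

balance-covers : ∀ c a b → (balance a b ≡ ∅ ⊎ b ≡ ∅) ⊎ (Has c (balance a b) ⊎ Has c b)
balance-covers c  ∅   _   = inj₁ (inj₁ refl)
balance-covers c  l1  ∅   = inj₁ (inj₂ refl)
balance-covers c  l2  ∅   = inj₁ (inj₂ refl)
balance-covers c  l12 ∅   = inj₁ (inj₂ refl)
balance-covers c₁ _   l1  = inj₂ (inj₂ tt)
balance-covers c₁ _   l12 = inj₂ (inj₂ tt)
balance-covers c₁ l1  l2  = inj₂ (inj₁ tt)
balance-covers c₁ l2  l2  = inj₂ (inj₁ tt)
balance-covers c₁ l12 l2  = inj₂ (inj₁ tt)
balance-covers c₂ _   l2  = inj₂ (inj₂ tt)
balance-covers c₂ _   l12 = inj₂ (inj₂ tt)
balance-covers c₂ l1  l1  = inj₂ (inj₁ tt)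
balance-covers c₂ l2  l1  = inj₂ (inj₁ tt)
balance-covers c₂ l12 l1  = inj₂ (inj₁ tt)

pattern one = suc zero

twin-adjacent : ∀ {G} v g → LexAdj G K₂ v (g , zero) → v ≡ (g , one) ⊎ LexAdj G K₂ v (g , one)
twin-adjacent v         g (inj₁ v~g)        = inj₂ (inj₁ v~g)
twin-adjacent (g , one) g (inj₂ (refl , _)) = inj₁ refl

module _ (G : Graph) (f : LexVtx G K₂ → Label) where

  balanceFibres : LexVtx G K₂ → Label
  balanceFibres (g , zero) = balance (f (g , zero)) (f (g , one))
  balanceFibres (g , one)  = f (g , one)

  weight-balanceFibres : weight G K₂ balanceFibres ≡ weight G K₂ f
  weight-balanceFibres = weight-cong-size {G} {K₂} size-eq
    where
    size-eq : ∀ v → size (balanceFibres v) ≡ size (f v)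
    size-eq (g , zero) = balance-size (f (g , zero)) (f (g , one))
    size-eq (g , one)  = refl

  balanceFibres-∅ : ∀ v → balanceFibres v ≡ ∅ → f v ≡ ∅
  balanceFibres-∅ (g , zero) = balance-∅ (f (g , zero)) (f (g , one))
  balanceFibres-∅ (g , one)  e = e

  balanceFibres-isRDF : IsRDF G K₂ f → IsRDF G K₂ balanceFibres
  balanceFibres-isRDF rdf v e = neighbour c₁ , neighbour c₂
    where
    neighbour : ∀ c → ∃ λ u → LexAdj G K₂ v u × Has c (balanceFibres u)
    neighbour c with rdf-neighbour {G} {K₂} {f} rdf c v (balanceFibres-∅ v e)
    ... | (g , one)  , v~u , p = (g , one) , v~u , p
    ... | (g , zero) , v~u , p with balance-keeps c (f (g , zero)) (f (g , one)) p
    ...   | inj₁ q = (g , zero) , v~u , q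
    ...   | inj₂ q with twin-adjacent {G} v g v~u
    ...     | inj₂ v~twin = (g , one) , v~twin , q
    ...     | inj₁ refl   = contradiction (subst (Has c) (balanceFibres-∅ v e) q) (¬Has-∅ c)

  balanceFibres-isMinRDF : IsMinRDF G K₂ f → IsMinRDF G K₂ balanceFibres
  balanceFibres-isMinRDF (rdf , minimal) =
    balanceFibres-isRDF rdf ,
    λ f′ rdf′ → subst (_≤ weight G K₂ f′) (≡.sym weight-balanceFibres) (minimal f′ rdf′)

  balanceFibres-covered : ∀ c g → FibreCovered c G K₂ balanceFibres g
  balanceFibres-covered c g with balance-covers c (f (g , zero)) (f (g , one))
  ... | inj₁ (inj₁ e) = inj₁ (zero , e)
  ... | inj₁ (inj₂ e) = inj₁ (one , e)
  ... | inj₂ (inj₁ p) = inj₂ (zero , p)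
  ... | inj₂ (inj₂ p) = inj₂ (one , p)

lemma7 : (G : Graph) → NonTrivial G → Connected G →
    ∃ λ (f : LexVtx G K₂ → Label) →
      IsMinRDF G K₂ f × Dominates G (proj1 G K₂ f) × Dominates G (proj2 G K₂ f)
lemma7 G _ _ with ∃-minimumRDF G K₂
... | f , min =
  balanceFibres G f , min′ ,
  proj-dominates {G} {K₂} (proj₁ min′) c₁ (balanceFibres-covered G f c₁) ,
  proj-dominates {G} {K₂} (proj₁ min′) c₂ (balanceFibres-covered G f c₂)
  where
  min′ : IsMinRDF G K₂ (balanceFibres G f)
  min′ = balanceFibres-isMinRDF G f min
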